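{- Let $n\ge 4$ be an integer and let $f(n)$ be the minimum size (number of edges) of an edge-pancyclic simple graph of order $n$ having at least one edge. Then $$\frac{3n}{2}\le f(n)\le 2n-2.$$
   Context: All graphs are finite and simple. The order of a graph is its number of vertices and its size is its number of edges. A $k$-cycle is a cycle of length $k$. A graph $G$ of order $n$ is called edge-pancyclic if for every integer $k$ with $3\le k\le n$, every edge of $G$ lies in a $k$-cycle of $G$. -}

module Defs where

open import Data.Nat using (ℕ; zero; suc; _+_; _≤_; _<?_)
open import Data.Fin using (Fin; toℕ; fromℕ<)
import Data.Fin as F
open import Data.Bool using (Bool; true; false; _∧_; if_then_else_)
open import Data.List using (List; map)
open import Data.Nat.ListAction using (sum)
open import Data.List using () renaming (allFin to allFinL)
open import Data.Product using (Σ; ∃; ∃-syntax; _×_)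
open import Data.Sum using (_⊎_)
open import Relation.Nullary using (¬_; yes; no)
open import Relation.Nullary.Decidable using (⌊_⌋)
open import Relation.Binary.PropositionalEquality using (_≡_)
open import Function.Definitions using (Injective)

record Graph (n : ℕ) : Set where
  field
    adj   : Fin n → Fin n → Bool
    sym   : ∀ u v → adj u v ≡ adj v u
    irrefl : ∀ u → adj u u ≡ false
open Graph public

size : ∀ {n} → Graph n → ℕ
size {n} G = sum (map (λ i → sum (map (λ j →
  if ⌊ toℕ i <? toℕ j ⌋ ∧ adj G i j then 1 else 0) (allFinL n))) (allFinL n))

next : ∀ {k} → Fin k → Fin k
next {suc m} i with suc (toℕ i) <? suc m
... | yes p = fromℕ< p
... | no _  = F.zero

-- a k-cycle in G: k distinct vertices c 0 , … , c (k-1) with c i adjacent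
-- to c (i+1 mod k) for all i (k ≥ 3 is required where cycles are used)
IsCycle : ∀ {n} → Graph n → (k : ℕ) → (Fin k → Fin n) → Set
IsCycle G k c = Injective _≡_ _≡_ c × (∀ i → adj G (c i) (c (next i)) ≡ true)

EdgeInCycle : ∀ {n} → Graph n → ℕ → Fin n → Fin n → Set
EdgeInCycle {n} G k u v = Σ (Fin k → Fin n) λ c → IsCycle G k c ×
  (∃[ i ] ((c i ≡ u × c (next i) ≡ v) ⊎ (c i ≡ v × c (next i) ≡ u)))

EdgePancyclic : ∀ {n} → Graph n → Set
EdgePancyclic {n} G = ∀ k → 3 ≤ k → k ≤ n →
  ∀ u v → adj G u v ≡ true → EdgeInCycle G k u v

HasEdge : ∀ {n} → Graph n → Set
HasEdge {n} G = ∃[ u ] ∃[ v ] (adj G u v ≡ true)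

{-# OPTIONS --safe #-}

-- Let x be a vertex.  It lies on a Hamiltonian cycle, so it has a
-- neighbour a; the edge xa lies on a triangle xaw, and the edge aw on a
-- Hamiltonian cycle.  The two neighbours of x on that cycle cannot both be in
-- {a, w}: the cycle would then consist of the path a x w closed by the edge wa,
-- i.e. have length 3 < n.  So deg x ≥ 3 for every x, and 3n ≤ Σ deg = 2·size.
--
-- The wheel (a hub joined to every vertex of an (n−1)-cycle) has
-- (n − 1) + (n − 1) edges.  Up to a rotation of the rim, an edge of the wheel is
-- the spoke 0–1 or the rim edge 1–2 (vertex 0 being the hub), and both lie on the
-- k-cycle 0, 1, …, k − 1 for every 3 ≤ k ≤ n.

module Submission where

open import Defs hiding (sym)
open import Data.Nat using (ℕ; _≤_; _*_; _∸_)
open import Data.Product using (_×_; Σ)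

open import Data.Bool using (Bool; true; false; if_then_else_; _∧_)
open import Data.Bool.Properties using (∨-comm)
open import Data.Fin using (Fin; toℕ; inject₁; inject≤; punchIn; punchOut)
  renaming (zero to fzero; suc to fsuc)
import Data.Fin.Properties as Fin
open import Data.Fin.Properties
  using (_≟_; toℕ-injective; toℕ<n; toℕ-fromℕ<; toℕ-inject₁; toℕ-inject≤; inject≤-injective;
         punchInᵢ≢i; punchOut-injective; injective⇒≤; any?)
open import Data.Fin.Induction using (<-weakInduction)
open import Data.List using ([]; _∷_; length)
import Data.List.Base as List using (map; tabulate; allFin)
open import Data.List.Properties using (map-tabulate)
open import Data.List.Membership.Propositional using (_∈_; _∉_)
open import Data.List.Membership.Propositional.Properties using (∈-map⁺; ∈-map⁻)
open import Data.List.Membership.DecPropositional using () renaming (_∈?_ to member?)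
open import Data.List.Relation.Unary.All using (All; []; _∷_; zipWith)
open import Data.List.Relation.Unary.AllPairs using ([]; _∷_)
open import Data.List.Relation.Unary.Any using (here; there)
open import Data.List.Relation.Unary.Unique.Propositional using (Unique)
open import Data.Nat using (zero; suc; _+_; _<_; z≤n; s≤s; s≤s⁻¹; z<s; s<s; s<s⁻¹; NonZero)
open import Data.Nat.DivMod
  using (_%_; m<n⇒m%n≡m; n%n≡0; [m+n]%n≡m%n; %-distribˡ-+; m%n%n≡m%n; m≤n⇒[n∸m]%m≡n%m)
import Data.Nat.ListAction as ListAction
open import Data.Nat.Properties hiding (_≟_)
open import Algebra.Properties.CommutativeMonoid.Sum +-0-commutativeMonoid
  using (sum; sum-syntax; sum-remove; sum-cong-≗; sum-replicate-zero; ∑-distrib-+; ∑-comm)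
open import Data.Product using (∃-syntax; _,_; proj₁; proj₂)
import Data.Product as Product
open import Data.Sum using (_⊎_; inj₁; inj₂; [_,_])
import Data.Sum as Sum
open import Function.Base using (_∘_; case_of_)
open import Function.Definitions using (Injective)
import Function.Endo.Propositional as Endo
open import Relation.Binary.PropositionalEquality
  using (_≡_; _≢_; refl; sym; trans; cong; cong₂; subst; ≢-sym; module ≡-Reasoning)
open import Relation.Nullary using (yes; no; contradiction)
open import Relation.Nullary.Decidable using (⌊_⌋; does; _⊎-dec_; dec-true; dec-false)

-- The cyclic successor

[j+x]%n≢x : ∀ {j x n} .{{_ : NonZero n}} → 0 < j → j < n → x < n → (j + x) % n ≢ x
[j+x]%n≢x {j} {x} {n} 0<j j<n x<n eq with j + x <? n
... | yes j+x<n = <-irrefl (trans (sym eq) (m<n⇒m%n≡m j+x<n)) (m<n+m x 0<j)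
... | no j+x≮n  = <-irrefl (+-cancelʳ-≡ x j n j+x≡n+x) j<n
  where
  n≤j+x = ≮⇒≥ j+x≮n
  wrapped : j + x ∸ n ≡ x
  wrapped = begin
    j + x ∸ n       ≡⟨ m<n⇒m%n≡m (m<n+o⇒m∸n<o (j + x) n (+-mono-< j<n x<n)) ⟨
    (j + x ∸ n) % n ≡⟨ m≤n⇒[n∸m]%m≡n%m n≤j+x ⟩
    (j + x) % n     ≡⟨ eq ⟩
    x               ∎
    where open ≡-Reasoning
  j+x≡n+x : j + x ≡ n + x
  j+x≡n+x = trans (sym (m∸n+n≡m n≤j+x)) (trans (cong (_+ n) wrapped) (+-comm x n))

[1+m%n]%n≡[1+m]%n : ∀ m n .{{_ : NonZero n}} → suc (m % n) % n ≡ suc m % n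
[1+m%n]%n≡[1+m]%n m n = begin
  (1 + m % n) % n         ≡⟨ %-distribˡ-+ 1 (m % n) n ⟩
  (1 % n + m % n % n) % n ≡⟨ cong (λ t → (1 % n + t) % n) (m%n%n≡m%n m n) ⟩
  (1 % n + m % n) % n     ≡⟨ %-distribˡ-+ 1 m n ⟨
  (1 + m) % n             ∎
  where open ≡-Reasoning

next-cases : ∀ {k} (i : Fin k) →
             toℕ (next i) ≡ suc (toℕ i) ⊎ (toℕ (next i) ≡ 0 × suc (toℕ i) ≡ k)
next-cases {suc k} i with suc (toℕ i) <? suc k
... | yes i+1<k = inj₁ (toℕ-fromℕ< i+1<k)
... | no i+1≮k  = inj₂ (refl , ≤-antisym (toℕ<n i) (≮⇒≥ i+1≮k))

toℕ-next : ∀ {k} (i : Fin (suc k)) → toℕ (next i) ≡ suc (toℕ i) % suc k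
toℕ-next {k} i with next-cases i
... | inj₁ i+1          = trans i+1 (sym (m<n⇒m%n≡m (subst (_< suc k) i+1 (toℕ<n (next i)))))
... | inj₂ (0≡ , i+1≡k) = trans 0≡ (sym (trans (cong (_% suc k) i+1≡k) (n%n≡0 (suc k))))

next-injective : ∀ {k} → Injective _≡_ _≡_ (next {k})
next-injective {k} {i} {j} eq = toℕ-injective (cases (next-cases i) (next-cases j) (cong toℕ eq))
  where
  cases : ∀ {x y a b} → a ≡ suc x ⊎ (a ≡ 0 × suc x ≡ k) →
          b ≡ suc y ⊎ (b ≡ 0 × suc y ≡ k) → a ≡ b → x ≡ y
  cases (inj₁ refl)         (inj₁ refl)         refl = refl
  cases (inj₂ (refl , x≡k)) (inj₂ (refl , y≡k)) refl = suc-injective (trans x≡k (sym y≡k))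

toℕ-suc⇒next : ∀ {k} {i j : Fin k} → toℕ j ≡ suc (toℕ i) → next i ≡ j
toℕ-suc⇒next {i = i} {j} j≡i+1 with next-cases i
... | inj₁ i+1        = toℕ-injective (trans i+1 (sym j≡i+1))
... | inj₂ (_ , i+1≡k) = contradiction (toℕ<n j) (<-irrefl (trans j≡i+1 i+1≡k))

next-induction : ∀ {k} (P : Fin (suc k) → Set) →
                 P fzero → (∀ i → P i → P (next i)) → ∀ i → P i
next-induction P P₀ P⇒Pnext =
  <-weakInduction P P₀ (λ i → subst P (next-inject₁ i) ∘ P⇒Pnext (inject₁ i))
  where
  next-inject₁ : ∀ i → next (inject₁ i) ≡ fsuc i
  next-inject₁ i = toℕ-suc⇒next (cong suc (sym (toℕ-inject₁ i)))

module _ {k : ℕ} where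
  open Endo (Fin (suc k)) using (_^_)

  toℕ-next^ : ∀ j (i : Fin (suc k)) → toℕ ((next ^ j) i) ≡ (j + toℕ i) % suc k
  toℕ-next^ zero    i = sym (m<n⇒m%n≡m (toℕ<n i))
  toℕ-next^ (suc j) i = begin
    toℕ (next ((next ^ j) i))         ≡⟨ toℕ-next _ ⟩
    suc (toℕ ((next ^ j) i)) % suc k  ≡⟨ cong (λ t → suc t % suc k) (toℕ-next^ j i) ⟩
    suc ((j + toℕ i) % suc k) % suc k ≡⟨ [1+m%n]%n≡[1+m]%n (j + toℕ i) (suc k) ⟩
    suc (j + toℕ i) % suc k           ∎
    where open ≡-Reasoning

  next^k≡id : (i : Fin (suc k)) → (next ^ suc k) i ≡ i
  next^k≡id i = toℕ-injective (begin
    toℕ ((next ^ suc k) i)  ≡⟨ toℕ-next^ (suc k) i ⟩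
    (suc k + toℕ i) % suc k ≡⟨ cong (_% suc k) (+-comm (suc k) (toℕ i)) ⟩
    (toℕ i + suc k) % suc k ≡⟨ [m+n]%n≡m%n (toℕ i) (suc k) ⟩
    toℕ i % suc k           ≡⟨ m<n⇒m%n≡m (toℕ<n i) ⟩
    toℕ i                   ∎)
    where open ≡-Reasoning

  next^-fixpoint-free : ∀ {j} (i : Fin (suc k)) → 0 < j → j < suc k → (next ^ j) i ≢ i
  next^-fixpoint-free {j} i 0<j j<k eq =
    [j+x]%n≢x 0<j j<k (toℕ<n i) (trans (sym (toℕ-next^ j i)) (cong toℕ eq))

  -- If i and i + 2 both lay in {l, l + 1}, then i = l + 1 and l + 3 or l + 2 would be l.
  next-escape : 4 ≤ suc k → ∀ i l → next i ∉ l ∷ next l ∷ [] →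
                i ∉ l ∷ next l ∷ [] ⊎ next (next i) ∉ l ∷ next l ∷ []
  next-escape 4≤k i l i₁∉
    with member? _≟_ i (l ∷ next l ∷ []) | member? _≟_ (next (next i)) (l ∷ next l ∷ [])
  ... | no i₀∉                  | _                        = inj₁ i₀∉
  ... | yes _                   | no i₂∉                   = inj₂ i₂∉
  ... | yes (here refl)         | yes _                    = contradiction (there (here refl)) i₁∉
  ... | yes (there (here refl)) | yes (here l₃≡l)          =
    contradiction l₃≡l (next^-fixpoint-free l z<s 4≤k)
  ... | yes (there (here refl)) | yes (there (here l₃≡l₁)) =
    contradiction (next-injective l₃≡l₁) (next^-fixpoint-free l z<s (≤-trans (n≤1+n 3) 4≤k))

next≢id : ∀ {k} → 2 ≤ k → (i : Fin k) → next i ≢ i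
next≢id {suc k} 2≤k i = next^-fixpoint-free i z<s 2≤k

-- Injections and counting

injective⇒surjective : ∀ {n} {f : Fin n → Fin n} → Injective _≡_ _≡_ f →
                       ∀ y → ∃[ x ] f x ≡ y
injective⇒surjective {n} {f} f-inj y with any? (λ x → f x ≟ y)
... | yes hit = hit
injective⇒surjective {suc n} {f} f-inj y | no miss =
  contradiction (injective⇒≤ squeeze-injective) (<-irrefl refl)
  where
  y∉image : ∀ x → y ≢ f x
  y∉image x y≡fx = miss (x , sym y≡fx)
  squeeze : Fin (suc n) → Fin n
  squeeze x = punchOut (y∉image x)
  squeeze-injective : Injective _≡_ _≡_ squeeze
  squeeze-injective {x} {x′} eq = f-inj (punchOut-injective (y∉image x) (y∉image x′) eq)

injective-∉ : ∀ {A B : Set} {f : A → B} {x xs} → Injective _≡_ _≡_ f →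
              x ∉ xs → f x ∉ List.map f xs
injective-∉ {f = f} {xs = xs} f-inj x∉xs fx∈ with ∈-map⁻ f fx∈
... | y , y∈xs , fx≡fy = x∉xs (subst (_∈ xs) (sym (f-inj fx≡fy)) y∈xs)

∑-const : ∀ n c → ∑[ i < n ] c ≡ n * c
∑-const zero    c = refl
∑-const (suc n) c = cong (c +_) (∑-const n c)

∑-mono-≤ : ∀ {n} {f g : Fin n → ℕ} → (∀ i → f i ≤ g i) → sum f ≤ sum g
∑-mono-≤ {zero}  _   = z≤n
∑-mono-≤ {suc n} f≤g = +-mono-≤ (f≤g fzero) (∑-mono-≤ (f≤g ∘ fsuc))

sum-tabulate : ∀ {n} (f : Fin n → ℕ) → ListAction.sum (List.tabulate f) ≡ sum f
sum-tabulate {zero}  f = refl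
sum-tabulate {suc n} f = cong (f fzero +_) (sum-tabulate (f ∘ fsuc))

indicator : Bool → ℕ
indicator b = if b then 1 else 0

count : ∀ {n} → (Fin n → Bool) → ℕ
count {n} P = ∑[ i < n ] indicator (P i)

_∖_ : ∀ {n} → (Fin n → Bool) → Fin n → Fin n → Bool
(P ∖ a) x with x ≟ a
... | yes _ = false
... | no _  = P x

∖-true⁺ : ∀ {n} {P : Fin n → Bool} {a x} → P x ≡ true → x ≢ a → (P ∖ a) x ≡ true
∖-true⁺ {a = a} {x} Px x≢a with x ≟ a
... | yes x≡a = contradiction x≡a x≢a
... | no _    = Px

∖-true⁻ : ∀ {n} {P : Fin n → Bool} {a x} → (P ∖ a) x ≡ true → P x ≡ true × x ≢ a
∖-true⁻ {a = a} {x} P∖ax with x ≟ a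
... | no x≢a = P∖ax , x≢a

count-remove : ∀ {n} (P : Fin n → Bool) a → count P ≡ indicator (P a) + count (P ∖ a)
count-remove {suc n} P a = begin
  count P                                  ≡⟨ sum-remove {i = a} (indicator ∘ P) ⟩
  Pa + sum (indicator ∘ P ∘ punchIn a)     ≡⟨ cong (Pa +_) (sum-cong-≗ (cong indicator ∘ kept)) ⟩
  Pa + rest                                ≡⟨ cong (λ b → Pa + (indicator b + rest)) removed ⟨
  Pa + (indicator ((P ∖ a) a) + rest)      ≡⟨ cong (Pa +_) (sum-remove {i = a} (indicator ∘ (P ∖ a))) ⟨
  Pa + count (P ∖ a)                       ∎
  where
  open ≡-Reasoning
  Pa   = indicator (P a)
  rest = sum (indicator ∘ (P ∖ a) ∘ punchIn a)
  kept : ∀ j → P (punchIn a j) ≡ (P ∖ a) (punchIn a j)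
  kept j with punchIn a j ≟ a
  ... | yes aⱼ≡a = contradiction aⱼ≡a (punchInᵢ≢i a j)
  ... | no _     = refl
  removed : (P ∖ a) a ≡ false
  removed with a ≟ a
  ... | yes _  = refl
  ... | no a≢a = contradiction refl a≢a

count-≤-length : ∀ {n} (P : Fin n → Bool) xs →
                 (∀ x → P x ≡ true → x ∈ xs) → count P ≤ length xs
count-≤-length {n} P [] P⊆[] = ≤-reflexive (trans (sum-cong-≗ empty) (sum-replicate-zero n))
  where
  empty : ∀ x → indicator (P x) ≡ 0
  empty x with P x in Px
  ... | false = refl
  ... | true  = case P⊆[] x Px of λ ()
count-≤-length P (a ∷ xs) P⊆a∷xs = begin
  count P                         ≡⟨ count-remove P a ⟩
  indicator (P a) + count (P ∖ a) ≤⟨ +-mono-≤ (indicator≤1 (P a))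
                                              (count-≤-length (P ∖ a) xs P∖a⊆xs) ⟩
  1 + length xs                   ∎
  where
  open ≤-Reasoning
  indicator≤1 : ∀ b → indicator b ≤ 1
  indicator≤1 false = z≤n
  indicator≤1 true  = ≤-refl
  P∖a⊆xs : ∀ x → (P ∖ a) x ≡ true → x ∈ xs
  P∖a⊆xs x P∖ax with ∖-true⁻ {P = P} P∖ax
  ... | Px , x≢a with P⊆a∷xs x Px
  ... | here x≡a   = contradiction x≡a x≢a
  ... | there x∈xs = x∈xs

length-≤-count : ∀ {n} (P : Fin n → Bool) xs →
                 Unique xs → All (λ x → P x ≡ true) xs → length xs ≤ count P
length-≤-count P []       _                  _          = z≤n
length-≤-count P (a ∷ xs) (a∉xs ∷ xs-unique) (Pa ∷ Pxs) = begin
  1 + length xs                   ≤⟨ s≤s (length-≤-count (P ∖ a) xs xs-unique P∖a-xs) ⟩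
  1 + count (P ∖ a)               ≡⟨ cong (λ b → indicator b + count (P ∖ a)) Pa ⟨
  indicator (P a) + count (P ∖ a) ≡⟨ count-remove P a ⟨
  count P                         ∎
  where
  open ≤-Reasoning
  P∖a-xs : All (λ x → (P ∖ a) x ≡ true) xs
  P∖a-xs = zipWith (λ (Px , a≢x) → ∖-true⁺ {P = P} Px (≢-sym a≢x)) (Pxs , a∉xs)

-- Degrees

deg : ∀ {n} → Graph n → Fin n → ℕ
deg G v = count (adj G v)

adj⇒≢ : ∀ {n} (G : Graph n) {u v} → adj G u v ≡ true → u ≢ v
adj⇒≢ G {u} u~v refl = case trans (sym (irrefl G u)) u~v of λ ()

module _ {n : ℕ} (G : Graph n) where

  upper : Fin n → Fin n → ℕ
  upper i j = indicator (⌊ toℕ i <? toℕ j ⌋ ∧ adj G i j)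

  size-∑ : size G ≡ ∑[ i < n ] ∑[ j < n ] upper i j
  size-∑ = trans (sum-map-allFin _) (sum-cong-≗ (sum-map-allFin ∘ upper))
    where
    sum-map-allFin : (f : Fin n → ℕ) → ListAction.sum (List.map f (List.allFin n)) ≡ sum f
    sum-map-allFin f = trans (cong ListAction.sum (map-tabulate (λ i → i) f)) (sum-tabulate f)

  indicator-adj : ∀ i j → indicator (adj G i j) ≡ upper i j + upper j i
  indicator-adj i j with toℕ i <? toℕ j | toℕ j <? toℕ i
  ... | yes i<j | yes j<i = contradiction i<j (<-asym j<i)
  ... | yes _   | no _    = sym (+-identityʳ _)
  ... | no _    | yes _   = cong indicator (Graph.sym G i j)
  ... | no i≮j  | no j≮i  with toℕ-injective (≤-antisym (≮⇒≥ j≮i) (≮⇒≥ i≮j))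
  ...   | refl = cong indicator (irrefl G i)

  handshake : ∑[ v < n ] deg G v ≡ 2 * size G
  handshake = begin
    ∑[ i < n ] ∑[ j < n ] indicator (adj G i j)
      ≡⟨ sum-cong-≗ (sum-cong-≗ ∘ indicator-adj) ⟩
    ∑[ i < n ] ∑[ j < n ] (upper i j + upper j i)
      ≡⟨ sum-cong-≗ (λ i → ∑-distrib-+ (upper i) (λ j → upper j i)) ⟩
    ∑[ i < n ] (∑[ j < n ] upper i j + ∑[ j < n ] upper j i)
      ≡⟨ ∑-distrib-+ (λ i → ∑[ j < n ] upper i j) (λ i → ∑[ j < n ] upper j i) ⟩
    ∑upper + ∑[ i < n ] ∑[ j < n ] upper j i
      ≡⟨ cong (∑upper +_) (∑-comm (λ i j → upper j i)) ⟩
    ∑upper + ∑upper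
      ≡⟨ cong (λ s → s + s) size-∑ ⟨
    size G + size G
      ≡⟨ cong (size G +_) (+-identityʳ (size G)) ⟨
    2 * size G
      ∎
    where
    open ≡-Reasoning
    ∑upper = ∑[ i < n ] ∑[ j < n ] upper i j

-- Cycles

module _ {m n} {G : Graph m} {H : Graph n} {f : Fin m → Fin n} (f-inj : Injective _≡_ _≡_ f)
         (f-adj : ∀ {u v} → adj G u v ≡ true → adj H (f u) (f v) ≡ true) where

  EdgeInCycle-map : ∀ {k u v} → EdgeInCycle G k u v → EdgeInCycle H k (f u) (f v)
  EdgeInCycle-map (c , (c-inj , c-adj) , i , uv-at-i) =
    f ∘ c , (c-inj ∘ f-inj , f-adj ∘ c-adj) , i , Sum.map both both uv-at-i
    where
    both : ∀ {a b c d} → a ≡ b × c ≡ d → f a ≡ f b × f c ≡ f d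
    both = Product.map (cong f) (cong f)

EdgeInCycle-swap : ∀ {n k} {G : Graph n} {u v} → EdgeInCycle G k u v → EdgeInCycle G k v u
EdgeInCycle-swap (c , c-cyc , i , uv-at-i) = c , c-cyc , i , Sum.swap uv-at-i

module _ {n : ℕ} {G : Graph n} where

  triangle-apex : ∀ {u v} → EdgeInCycle G 3 u v → ∃[ w ] adj G u w ≡ true × adj G v w ≡ true
  triangle-apex {u} {v} (c , (_ , c-adj) , x , uv-at-x) = apex uv-at-x
    where
    y = next x
    z = next y
    x~z : adj G (c x) (c z) ≡ true
    x~z = trans (Graph.sym G _ _) (subst (λ t → adj G (c z) (c t) ≡ true) (next^k≡id x) (c-adj z))
    apex : (c x ≡ u × c y ≡ v) ⊎ (c x ≡ v × c y ≡ u) →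
           ∃[ w ] adj G u w ≡ true × adj G v w ≡ true
    apex (inj₁ (refl , refl)) = c z , x~z , c-adj y
    apex (inj₂ (refl , refl)) = c z , c-adj y , x~z

  off-edge-neighbour : ∀ {k} {e : Fin (suc k) → Fin n} → 4 ≤ suc k → IsCycle G (suc k) e →
                       ∀ i l → next i ∉ l ∷ next l ∷ [] →
                       ∃[ r ] adj G (e (next i)) r ≡ true × r ∉ e l ∷ e (next l) ∷ []
  off-edge-neighbour {e = e} 4≤k (e-inj , e-adj) i l i₁∉ with next-escape 4≤k i l i₁∉
  ... | inj₁ i₀∉ = e i , trans (Graph.sym G _ _) (e-adj i) , injective-∉ e-inj i₀∉
  ... | inj₂ i₂∉ = e (next (next i)) , e-adj (next i) , injective-∉ e-inj i₂∉

-- The lower bound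

module _ {n : ℕ} {G : Graph (suc n)} (pancyclic : EdgePancyclic G) (4≤order : 4 ≤ suc n) where

  3≤order : 3 ≤ suc n
  3≤order = ≤-trans (n≤1+n 3) 4≤order

  hamiltonian-through : ∀ {u v} → adj G u v ≡ true → EdgeInCycle G (suc n) u v
  hamiltonian-through = pancyclic (suc n) 3≤order ≤-refl _ _

  flanks-cycle-edge⇒3≤deg : ∀ {x p q e l} → IsCycle G (suc n) e → e l ≡ p → e (next l) ≡ q →
                             adj G x p ≡ true → adj G x q ≡ true → 3 ≤ deg G x
  flanks-cycle-edge⇒3≤deg {x} {e = e} {l} e-cyc@(e-inj , e-adj) refl refl x~p x~q
    with injective⇒surjective {f = e ∘ next} (next-injective ∘ e-inj) x
  ... | i , refl with off-edge-neighbour {G = G} 4≤order e-cyc i l (x∉pq ∘ ∈-map⁺ e)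
    where
    x∉pq : e (next i) ∉ e l ∷ e (next l) ∷ []
    x∉pq (here x≡p)         = adj⇒≢ G x~p x≡p
    x∉pq (there (here x≡q)) = adj⇒≢ G x~q x≡q
  ... | r , x~r , r∉pq =
    length-≤-count (adj G x) (e l ∷ e (next l) ∷ r ∷ []) distinct (x~p ∷ x~q ∷ x~r ∷ [])
    where
    distinct : Unique (e l ∷ e (next l) ∷ r ∷ [])
    distinct = (adj⇒≢ G (e-adj l) ∷ (λ p≡r → r∉pq (here (sym p≡r))) ∷ [])
             ∷ ((λ q≡r → r∉pq (there (here (sym q≡r)))) ∷ [])
             ∷ []
             ∷ []

  neighbour⇒3≤deg : ∀ {x a} → adj G x a ≡ true → 3 ≤ deg G x
  neighbour⇒3≤deg {x} {a} x~a with triangle-apex {G = G} (pancyclic 3 ≤-refl 3≤order x a x~a)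
  ... | w , x~w , a~w with hamiltonian-through a~w
  ... | e , e-cyc , _ , inj₁ (eₗ≡a , eₗ₊₁≡w) =
    flanks-cycle-edge⇒3≤deg e-cyc eₗ≡a eₗ₊₁≡w x~a x~w
  ... | e , e-cyc , _ , inj₂ (eₗ≡w , eₗ₊₁≡a) =
    flanks-cycle-edge⇒3≤deg e-cyc eₗ≡w eₗ₊₁≡a x~w x~a

  pancyclic⇒3≤deg : HasEdge G → ∀ x → 3 ≤ deg G x
  pancyclic⇒3≤deg (u , v , u~v) x with hamiltonian-through u~v
  ... | c , (c-inj , c-adj) , _ with injective⇒surjective c-inj x
  ... | i , refl = neighbour⇒3≤deg (c-adj i)

  pancyclic-size-lower-bound : HasEdge G → 3 * suc n ≤ 2 * size G
  pancyclic-size-lower-bound has-edge = begin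
    3 * suc n              ≡⟨ *-comm 3 (suc n) ⟩
    suc n * 3              ≡⟨ ∑-const (suc n) 3 ⟨
    ∑[ x < suc n ] 3       ≤⟨ ∑-mono-≤ (pancyclic⇒3≤deg has-edge) ⟩
    ∑[ x < suc n ] deg G x ≡⟨ handshake G ⟩
    2 * size G             ∎
    where open ≤-Reasoning

-- The wheel

cycleGraph : ∀ {m} → 2 ≤ m → Graph m
cycleGraph 2≤m = record
  { adj    = λ x y → does (next x ≟ y ⊎-dec next y ≟ x)
  ; sym    = λ x y → ∨-comm (does (next x ≟ y)) (does (next y ≟ x))
  ; irrefl = λ x → dec-false (next x ≟ x ⊎-dec next x ≟ x)
                              [ next≢id 2≤m x , next≢id 2≤m x ]
  }

cone : ∀ {m} → Graph m → Graph (suc m)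
cone {m} H = record { adj = join ; sym = join-sym ; irrefl = join-irrefl }
  where
  join : Fin (suc m) → Fin (suc m) → Bool
  join fzero    fzero    = false
  join fzero    (fsuc _) = true
  join (fsuc _) fzero    = true
  join (fsuc x) (fsuc y) = adj H x y
  join-sym : ∀ u v → join u v ≡ join v u
  join-sym fzero    fzero    = refl
  join-sym fzero    (fsuc _) = refl
  join-sym (fsuc _) fzero    = refl
  join-sym (fsuc x) (fsuc y) = Graph.sym H x y
  join-irrefl : ∀ u → join u u ≡ false
  join-irrefl fzero    = refl
  join-irrefl (fsuc x) = irrefl H x

wheel : ∀ {m} → 2 ≤ m → Graph (suc m)
wheel 2≤m = cone (cycleGraph 2≤m)

cone-size : ∀ {m} (H : Graph m) → size (cone H) ≡ m + size H
cone-size {m} H = begin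
  size (cone H)
    ≡⟨ size-∑ (cone H) ⟩
  (0 + ∑[ j < m ] 1) + ∑[ i < m ] (0 + ∑[ j < m ] upper (cone H) (fsuc i) (fsuc j))
    ≡⟨ cong₂ _+_ (∑-const m 1) (sum-cong-≗ (sum-cong-≗ ∘ rim-upper)) ⟩
  m * 1 + ∑[ i < m ] ∑[ j < m ] upper H i j
    ≡⟨ cong₂ _+_ (*-identityʳ m) (sym (size-∑ H)) ⟩
  m + size H
    ∎
  where
  open ≡-Reasoning
  rim-upper : ∀ i j → upper (cone H) (fsuc i) (fsuc j) ≡ upper H i j
  rim-upper i j with toℕ i <? toℕ j | suc (toℕ i) <? suc (toℕ j)
  ... | yes _   | yes _       = refl
  ... | no _    | no _        = refl
  ... | yes i<j | no i+1≮j+1  = contradiction (s<s i<j) i+1≮j+1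
  ... | no i≮j  | yes i+1<j+1 = contradiction (s<s⁻¹ i+1<j+1) i≮j

module _ {m} (2≤m : 2 ≤ m) where

  private
    C = cycleGraph 2≤m
    W = wheel 2≤m

  cycle-adj⁻ : ∀ {x y} → adj C x y ≡ true → next x ≡ y ⊎ next y ≡ x
  cycle-adj⁻ {x} {y} x~y with next x ≟ y | next y ≟ x
  ... | yes x→y | _       = inj₁ x→y
  ... | no _    | yes y→x = inj₂ y→x

  cycle-adj⁺ : ∀ {x y} → next x ≡ y ⊎ next y ≡ x → adj C x y ≡ true
  cycle-adj⁺ {x} {y} = dec-true (next x ≟ y ⊎-dec next y ≟ x)

  cycle-deg≤2 : ∀ x → deg C x ≤ 2
  cycle-deg≤2 x with injective⇒surjective next-injective x
  ... | p , p→x = count-≤-length (adj C x) (next x ∷ p ∷ []) neighbours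
    where
    neighbours : ∀ y → adj C x y ≡ true → y ∈ next x ∷ p ∷ []
    neighbours y x~y with cycle-adj⁻ x~y
    ... | inj₁ x→y = here (sym x→y)
    ... | inj₂ y→x = there (here (next-injective (trans y→x (sym p→x))))

  cycle-size≤ : size C ≤ m
  cycle-size≤ = *-cancelˡ-≤ 2 (begin
    2 * size C         ≡⟨ handshake C ⟨
    ∑[ x < m ] deg C x ≤⟨ ∑-mono-≤ cycle-deg≤2 ⟩
    ∑[ x < m ] 2       ≡⟨ ∑-const m 2 ⟩
    m * 2              ≡⟨ *-comm m 2 ⟩
    2 * m              ∎)
    where open ≤-Reasoning

  wheel-size≤ : size W ≤ 2 * suc m ∸ 2
  wheel-size≤ = begin
    size W        ≡⟨ cone-size C ⟩
    m + size C    ≤⟨ +-monoʳ-≤ m cycle-size≤ ⟩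
    m + m         ≡⟨ cong (m +_) (+-identityʳ m) ⟨
    2 * m         ≡⟨ m+n∸m≡n 2 (2 * m) ⟨
    2 + 2 * m ∸ 2 ≡⟨ cong (_∸ 2) (*-suc 2 m) ⟨
    2 * suc m ∸ 2 ∎
    where open ≤-Reasoning

  rotate : Fin (suc m) → Fin (suc m)
  rotate fzero    = fzero
  rotate (fsuc x) = fsuc (next x)

  rotate-injective : Injective _≡_ _≡_ rotate
  rotate-injective {fzero}  {fzero}  _  = refl
  rotate-injective {fsuc x} {fsuc y} eq = cong fsuc (next-injective (Fin.suc-injective eq))

  rotate-adj : ∀ {u v} → adj W u v ≡ true → adj W (rotate u) (rotate v) ≡ true
  rotate-adj {fzero}  {fsuc _} _   = refl
  rotate-adj {fsuc _} {fzero}  _   = refl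
  rotate-adj {fsuc x} {fsuc y} x~y = cycle-adj⁺ (Sum.map (cong next) (cong next) (cycle-adj⁻ x~y))

  hub-cycle : ∀ {k} (k≤ : k ≤ suc m) → 3 ≤ k → IsCycle W k (λ i → inject≤ i k≤)
  hub-cycle {k} k≤ 3≤k = (λ {i} {j} → inject≤-injective k≤ k≤ i j) , consecutive
    where
    forward : ∀ {u v} → toℕ v ≡ suc (toℕ u) → adj W u v ≡ true
    forward {fzero}  {fsuc _} _      = refl
    forward {fsuc x} {fsuc y} y≡x+1 = cycle-adj⁺ (inj₁ (toℕ-suc⇒next (suc-injective y≡x+1)))
    back : ∀ {u v} → toℕ v ≡ 0 → 0 < toℕ u → adj W u v ≡ true
    back {fsuc _} {fzero} _ _ = refl
    consecutive : ∀ i → adj W (inject≤ i k≤) (inject≤ (next i) k≤) ≡ true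
    consecutive i with next-cases i
    ... | inj₁ i+1 =
      forward (trans (toℕ-inject≤ (next i) k≤) (trans i+1 (cong suc (sym (toℕ-inject≤ i k≤)))))
    ... | inj₂ (0≡ , i+1≡k) =
      back (trans (toℕ-inject≤ (next i) k≤) 0≡) (subst (0 <_) (sym (toℕ-inject≤ i k≤)) 0<i)
      where
      0<i : 0 < toℕ i
      0<i = ≤-trans (n≤1+n 1) (s≤s⁻¹ (subst (3 ≤_) (sym i+1≡k) 3≤k))

wheel-pancyclic : ∀ {m} (2≤m : 2 ≤ m) → EdgePancyclic (wheel 2≤m)
wheel-pancyclic 2≤m@(s≤s (s≤s _)) k 3≤k@(s≤s (s≤s (s≤s _))) k≤ = edge
  where
  W = wheel 2≤m
  on-hub-cycle : ∀ i → EdgeInCycle W k (inject≤ i k≤) (inject≤ (next i) k≤)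
  on-hub-cycle i = (λ j → inject≤ j k≤) , hub-cycle 2≤m k≤ 3≤k , i , inj₁ (refl , refl)
  rotate-edge : ∀ {u v} → EdgeInCycle W k u v → EdgeInCycle W k (rotate 2≤m u) (rotate 2≤m v)
  rotate-edge = EdgeInCycle-map {G = W} {H = W} (rotate-injective 2≤m)
                                (λ {u} {v} → rotate-adj 2≤m {u} {v})
  spoke-and-rim : ∀ x → EdgeInCycle W k fzero (fsuc x) × EdgeInCycle W k (fsuc x) (fsuc (next x))
  spoke-and-rim = next-induction _ (on-hub-cycle fzero , on-hub-cycle (fsuc fzero))
                                   (λ _ → Product.map rotate-edge rotate-edge)
  edge : ∀ u v → adj W u v ≡ true → EdgeInCycle W k u v
  edge fzero    (fsuc x) _   = proj₁ (spoke-and-rim x)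
  edge (fsuc x) fzero    _   = EdgeInCycle-swap {G = W} (proj₁ (spoke-and-rim x))
  edge (fsuc x) (fsuc y) x~y with cycle-adj⁻ 2≤m {x} {y} x~y
  ... | inj₁ refl = proj₂ (spoke-and-rim x)
  ... | inj₂ refl = EdgeInCycle-swap {G = W} (proj₂ (spoke-and-rim y))

theorem4 : (n : ℕ) → 4 ≤ n →
    ((G : Graph n) → EdgePancyclic G → HasEdge G → 3 * n ≤ 2 * size G)
    × Σ (Graph n) (λ G → EdgePancyclic G × HasEdge G × size G ≤ 2 * n ∸ 2)
theorem4 (suc m) 4≤n@(s≤s 3≤m@(s≤s _)) =
    (λ G pancyclic → pancyclic-size-lower-bound {G = G} pancyclic 4≤n)
  , wheel 2≤m , wheel-pancyclic 2≤m , (fzero , fsuc fzero , refl) , wheel-size≤ 2≤m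
  where
  2≤m : 2 ≤ m
  2≤m = ≤-trans (n≤1+n 2) 3≤m
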